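{- Let $q\geq 2$ be a prime power, $d\geq 6$, $2\leq j\leq d$, $1\leq i\leq d-3$, and $h_{\max}=\min\{j,d-i\}$. (i) If $j\leq d-i-1$, then $\frac{43}{78}|T_{h_{\max}}(i,j)|\leq |Q_j(i)|\leq \frac{113}{78}|T_{h_{\max}}(i,j)|$. (ii) If $j=d-i$, then $\frac{691}{1296}|T_{h_{\max}}(i,j)|\leq |Q_j(i)|\leq \frac{1901}{1296}|T_{h_{\max}}(i,j)|$. (iii) If $j\geq d-i+1$, then $\frac{31}{216}|T_{h_{\max}}(i,j)|\leq |Q_j(i)|\leq \frac{401}{216}|T_{h_{\max}}(i,j)|$. In particular, the sign of $Q_j(i)$ equals the sign of $T_{h_{\max}}(i,j)$.
   Context: Let $b=-q$. For integers $m\geq 0$ and $l$, ${m \brack l}_b=\prod_{t=1}^{l}\frac{(-q)^{m-t+1}-1}{(-q)^t-1}$ for $0\leq l\leq m$, and $0$ if $l<0$ or $l>m$. For $h\geq 0$, $T_h(i,j)=(-1)^j(-q)^{\binom{j-h}{2}+hd}{d-h \brack d-j}_b{d-i \brack h}_b$, and $Q_j(i)=\sum_{h=0}^{h_{\max}}T_h(i,j)$ is the $i$-th eigenvalue of the Hermitian forms graph $Q_q(d,j)$. -}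

module Defs where

open import Data.Nat as ℕ using (ℕ; zero; suc; _∸_; _⊔_; _⊓_)
open import Data.Nat.Combinatorics using (_C_)
open import Data.Nat.Primality using (Prime)
open import Data.Integer as ℤ using (ℤ)
open import Data.Rational as ℚ using (ℚ; 0ℚ; 1ℚ; _÷_; _<_; _/_)
open import Data.Rational.Properties using (_≟_; _<?_)
open import Data.Product using (Σ; _×_; ∃)
open import Relation.Nullary using (yes; no)
open import Relation.Binary.PropositionalEquality using (_≡_)

IsPrimePower : ℕ → Set
IsPrimePower q = Σ ℕ λ p → Σ ℕ λ k → Prime p × (q ≡ p ℕ.^ suc k)

ι : ℤ → ℚ
ι z = z / 1

bpow : ℕ → ℕ → ℚ
bpow q n = ι ((ℤ.- ℤ.+ q) ℤ.^ n)

-- division of rationals, total (returns 0 on a zero denominator;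
-- never triggered below since (-q)^t - 1 ≠ 0 for q ≥ 2, t ≥ 1)
_÷'_ : ℚ → ℚ → ℚ
x ÷' y with y ≟ 0ℚ
... | yes _ = 0ℚ
... | no y≢0 = _÷_ x y {{ℚ.≢-nonZero y≢0}}

gbProd : ℕ → ℕ → ℕ → ℚ
gbProd q m zero = 1ℚ
gbProd q m (suc l) =
  gbProd q m l ℚ.* ((bpow q (m ∸ suc l ℕ.+ 1) ℚ.- 1ℚ) ÷' (bpow q (suc l) ℚ.- 1ℚ))

-- Gaussian binomial [m, l]_b with b = -q (0 if l > m; l ≥ 0 automatically)
gbin : ℕ → ℕ → ℕ → ℚ
gbin q m l with l ℕ.≤? m
... | yes _ = gbProd q m l
... | no _ = 0ℚ

sgnPow : ℕ → ℚ
sgnPow j = ι ((ℤ.- ℤ.+ 1) ℤ.^ j)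

T : ℕ → ℕ → ℕ → ℕ → ℕ → ℚ
T q d h i j =
  sgnPow j ℚ.* bpow q ((j ∸ h) C 2 ℕ.+ h ℕ.* d)
    ℚ.* gbin q (d ∸ h) (d ∸ j) ℚ.* gbin q (d ∸ i) h

hmax : ℕ → ℕ → ℕ → ℕ
hmax d i j = j ⊓ (d ∸ i)

sumTo : ℕ → (ℕ → ℚ) → ℚ
sumTo zero f = f 0
sumTo (suc n) f = sumTo n f ℚ.+ f (suc n)

Q : ℕ → ℕ → ℕ → ℕ → ℚ
Q q d i j = sumTo (hmax d i j) (λ h → T q d h i j)

sign : ℚ → ℤ
sign x with x <? 0ℚ
... | yes _ = ℤ.- ℤ.+ 1
... | no _ with 0ℚ <? x
...   | yes _ = ℤ.+ 1
...   | no _ = ℤ.+ 0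

Between : ℚ → ℚ → ℚ → ℚ → Set
Between a b t x = (a ℚ.* ℚ.∣ t ∣ ℚ.≤ ℚ.∣ x ∣) × (ℚ.∣ x ∣ ℚ.≤ b ℚ.* ℚ.∣ t ∣)

module Submission where

-- Consecutive terms of Q_j(i) = Σ_{h ≤ h_max} T_h(i,j) have an explicit ratio: by the two absorption identities
-- for Gaussian binomials,
--   |T_g| / |T_{g+1}| = μ(d-g) μ(g+1) / (q^(d-j+g+1) μ(j-g) μ(d-i-g)),   where μ(n) = |(-q)^n - 1| = q^n ± 1.
-- Bounding each μ(n)/q^n from above and below (parity matters for small n, and for q = 2 the factor μ(1)/q is
-- used exactly) gives |T_g| ≤ c |T_{g+1}| with c = 3/10 away from the top index and, for the last two steps,
-- c ∈ {4/15, 13/25, 9/20, 3/10} according to which of j and d - i equals h_max. Summing the resulting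
-- geometric tail gives |Q_j(i) - T_{h_max}| ≤ s |T_{h_max}| with s = 35/78, 605/1296, 185/216 in the three
-- cases, which is the two-sided bound; s < 1 forces Q_j(i) and T_{h_max} to have the same sign.

open import Defs
open import Data.Nat as ℕ using (ℕ; zero; suc; z≤n; s≤s)
import Data.Nat.Properties as ℕP
open import Data.Nat.Combinatorics using (_C_; nCk+nC[k+1]≡[n+1]C[k+1]; nC1≡n)
open import Data.Nat.Tactic.RingSolver using (solve-∀)
open import Data.Nat.Primality using (prime⇒nonTrivial)
open import Data.Integer as ℤ using (ℤ; +_)
import Data.Integer.Properties as ℤP
open import Data.Rational as ℚ using (ℚ; 0ℚ; 1ℚ; ∣_∣)
import Data.Rational.Properties as ℚP
import Data.Rational.Unnormalised as ℚᵘ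
import Data.Rational.Unnormalised.Properties as ℚᵘP
open import Data.Rational.Solver using (module +-*-Solver)
open import Data.Product using (_,_)
open import Data.Sum using (_⊎_; inj₁; inj₂)
open import Data.Empty using (⊥-elim)
open import Relation.Nullary using (yes; no)
open import Relation.Nullary.Decidable using (True; toWitness)
open import Data.Unit using (tt)
open import Relation.Binary.PropositionalEquality
open import Relation.Binary.Definitions using (tri<; tri≈; tri>)

open +-*-Solver using (solve; _:+_; _:*_; _:-_; :-_; _:=_; con)

ι≃ : ∀ z → ℚ.toℚᵘ (ι z) ℚᵘ.≃ ℚᵘ.mkℚᵘ z 0
ι≃ z = ℚP.toℚᵘ-fromℚᵘ (ℚᵘ.mkℚᵘ z 0)

ι-homo-* : ∀ x y → ι (x ℤ.* y) ≡ ι x ℚ.* ι y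
ι-homo-* x y = ℚP.toℚᵘ-injective (ℚᵘP.≃-trans (ι≃ (x ℤ.* y))
  (ℚᵘP.≃-sym (ℚᵘP.≃-trans (ℚP.toℚᵘ-homo-* (ι x) (ι y)) (ℚᵘP.*-cong (ι≃ x) (ι≃ y)))))

ι-homo-+ : ∀ x y → ι (x ℤ.+ y) ≡ ι x ℚ.+ ι y
ι-homo-+ x y = ℚP.toℚᵘ-injective (ℚᵘP.≃-trans (ι≃ (x ℤ.+ y))
  (ℚᵘP.≃-sym (ℚᵘP.≃-trans (ℚP.toℚᵘ-homo-+ (ι x) (ι y))
    (ℚᵘP.≃-trans (ℚᵘP.+-cong (ι≃ x) (ι≃ y)) (ℚᵘ.*≡* (cong (ℤ._* + 1)
      (cong₂ ℤ._+_ (ℤP.*-identityʳ x) (ℤP.*-identityʳ y))))))))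

ι-homo‿- : ∀ x → ι (ℤ.- x) ≡ ℚ.- ι x
ι-homo‿- x = ℚP.toℚᵘ-injective (ℚᵘP.≃-trans (ι≃ (ℤ.- x))
  (ℚᵘP.≃-sym (ℚᵘP.≃-trans (ℚP.toℚᵘ-homo‿- (ι x)) (ℚᵘP.-‿cong (ι≃ x)))))

ι-homo-∣∣ : ∀ x → ℚ.∣ ι x ∣ ≡ ι (+ ℤ.∣ x ∣)
ι-homo-∣∣ x = ℚP.toℚᵘ-injective (ℚᵘP.≃-trans (ℚP.toℚᵘ-homo-∣-∣ (ι x))
  (ℚᵘP.≃-trans (ℚᵘP.∣-∣-cong (ι≃ x)) (ℚᵘP.≃-sym (ι≃ (+ ℤ.∣ x ∣)))))

ι-mono-≤ : ∀ {x y} → x ℤ.≤ y → ι x ℚ.≤ ι y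
ι-mono-≤ {x} {y} x≤y = ℚP.toℚᵘ-cancel-≤ (ℚᵘP.≤-respʳ-≃ (ℚᵘP.≃-sym (ι≃ y))
  (ℚᵘP.≤-respˡ-≃ (ℚᵘP.≃-sym (ι≃ x)) (ℚᵘ.*≤* (ℤP.*-monoʳ-≤-nonNeg (+ 1) x≤y))))

ι-mono-< : ∀ {x y} → x ℤ.< y → ι x ℚ.< ι y
ι-mono-< {x} {y} x<y = ℚP.toℚᵘ-cancel-< (ℚᵘP.<-respʳ-≃ (ℚᵘP.≃-sym (ι≃ y))
  (ℚᵘP.<-respˡ-≃ (ℚᵘP.≃-sym (ι≃ x)) (ℚᵘ.*<* (ℤP.*-monoʳ-<-pos (+ 1) x<y))))

ι-pos : ∀ {n} → 1 ℕ.≤ n → 0ℚ ℚ.< ι (+ n)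
ι-pos 1≤n = ι-mono-< (ℤ.+<+ 1≤n)

ιℕ-homo-* : ∀ x y → ι (+ (x ℕ.* y)) ≡ ι (+ x) ℚ.* ι (+ y)
ιℕ-homo-* x y = trans (cong ι (ℤP.pos-* x y)) (ι-homo-* (+ x) (+ y))

-- Gaussian binomials and the ratio of consecutive terms

δ : ℕ → ℕ → ℚ
δ q n = bpow q n ℚ.- 1ℚ

bpow-+ : ∀ q m n → bpow q (m ℕ.+ n) ≡ bpow q m ℚ.* bpow q n
bpow-+ q m n = trans (cong ι (ℤP.^-distribˡ-+-* (ℤ.- + q) m n))
  (ι-homo-* ((ℤ.- + q) ℤ.^ m) ((ℤ.- + q) ℤ.^ n))

inv : ℚ → ℚ
inv y = 1ℚ ÷' y

÷'≡*inv : ∀ x y → x ÷' y ≡ x ℚ.* inv y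
÷'≡*inv x y with y ℚP.≟ 0ℚ
... | yes _ = sym (ℚP.*-zeroʳ x)
... | no _ = cong (x ℚ.*_) (sym (ℚP.*-identityˡ _))

inv-inverseˡ : ∀ y → y ≢ 0ℚ → inv y ℚ.* y ≡ 1ℚ
inv-inverseˡ y y≢0 with y ℚP.≟ 0ℚ
... | yes y≡0 = ⊥-elim (y≢0 y≡0)
... | no y≢0' = trans (cong (ℚ._* y) (ℚP.*-identityˡ (ℚ.1/ y))) (ℚP.*-inverseˡ y)
  where instance _ = ℚ.≢-nonZero y≢0'

gbin≡gbProd : ∀ q m l → l ℕ.≤ m → gbin q m l ≡ gbProd q m l
gbin≡gbProd q m l l≤m with l ℕ.≤? m
... | yes _ = refl
... | no l≰m = ⊥-elim (l≰m l≤m)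

gbProd-suc-upper : ∀ q m l → l ℕ.≤ m →
  gbProd q (suc m) l ℚ.* δ q (suc m ℕ.∸ l) ≡ gbProd q m l ℚ.* δ q (suc m)
gbProd-suc-upper q m zero _ = refl
gbProd-suc-upper q m (suc l) l<m = begin
    P′ ℚ.* (δ q (m ℕ.∸ l ℕ.+ 1) ÷' D) ℚ.* δ q (m ℕ.∸ l)
      ≡⟨ cong₂ (λ x y → P′ ℚ.* x ℚ.* δ q y) (÷'≡*inv _ D) (sym m∸[1+l]+1≡m∸l) ⟩
    P′ ℚ.* (A ℚ.* inv D) ℚ.* δ q (m ℕ.∸ suc l ℕ.+ 1)
      ≡⟨ solve 4 (λ p a i c → p :* (a :* i) :* c := (p :* a) :* (c :* i)) refl P′ A (inv D) _ ⟩
    (P′ ℚ.* A) ℚ.* (δ q (m ℕ.∸ suc l ℕ.+ 1) ℚ.* inv D)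
      ≡⟨ cong₂ (λ x y → x ℚ.* y) IH (sym (÷'≡*inv _ D)) ⟩
    (P ℚ.* δ q (suc m)) ℚ.* (δ q (m ℕ.∸ suc l ℕ.+ 1) ÷' D)
      ≡⟨ solve 3 (λ p b x → (p :* b) :* x := p :* x :* b) refl P (δ q (suc m)) _ ⟩
    P ℚ.* (δ q (m ℕ.∸ suc l ℕ.+ 1) ÷' D) ℚ.* δ q (suc m) ∎
  where
  open ≡-Reasoning
  P′ = gbProd q (suc m) l
  P = gbProd q m l
  D = δ q (suc l)
  A = δ q (m ℕ.∸ l ℕ.+ 1)
  l≤m = ℕP.<⇒≤ l<m
  1+m∸l≡m∸l+1 : suc m ℕ.∸ l ≡ m ℕ.∸ l ℕ.+ 1
  1+m∸l≡m∸l+1 = trans (ℕP.+-∸-assoc 1 l≤m) (ℕP.+-comm 1 (m ℕ.∸ l))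
  IH : P′ ℚ.* A ≡ P ℚ.* δ q (suc m)
  IH = trans (cong (λ k → P′ ℚ.* δ q k) (sym 1+m∸l≡m∸l+1)) (gbProd-suc-upper q m l l≤m)
  m∸[1+l]+1≡m∸l : m ℕ.∸ suc l ℕ.+ 1 ≡ m ℕ.∸ l
  m∸[1+l]+1≡m∸l = trans (ℕP.+-comm (m ℕ.∸ suc l) 1) (sym (ℕP.+-∸-assoc 1 l<m))

gbin-suc-upper : ∀ q m l → l ℕ.≤ m →
  gbin q (suc m) l ℚ.* δ q (suc m ℕ.∸ l) ≡ gbin q m l ℚ.* δ q (suc m)
gbin-suc-upper q m l l≤m = begin
  gbin q (suc m) l ℚ.* δ q (suc m ℕ.∸ l)
    ≡⟨ cong (ℚ._* δ q (suc m ℕ.∸ l)) (gbin≡gbProd q (suc m) l (ℕP.m≤n⇒m≤1+n l≤m)) ⟩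
  gbProd q (suc m) l ℚ.* δ q (suc m ℕ.∸ l)
    ≡⟨ gbProd-suc-upper q m l l≤m ⟩
  gbProd q m l ℚ.* δ q (suc m)
    ≡⟨ cong (ℚ._* δ q (suc m)) (sym (gbin≡gbProd q m l l≤m)) ⟩
  gbin q m l ℚ.* δ q (suc m) ∎
  where open ≡-Reasoning

gbin-suc-lower : ∀ q n l → l ℕ.< n → δ q (suc l) ≢ 0ℚ →
  gbin q n (suc l) ℚ.* δ q (suc l) ≡ gbin q n l ℚ.* δ q (n ℕ.∸ l)
gbin-suc-lower q n l l<n D≢0 = begin
  gbin q n (suc l) ℚ.* D
    ≡⟨ cong (ℚ._* D) (gbin≡gbProd q n (suc l) l<n) ⟩
  gbProd q n l ℚ.* (E ÷' D) ℚ.* D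
    ≡⟨ cong (λ x → gbProd q n l ℚ.* x ℚ.* D) (÷'≡*inv E D) ⟩
  gbProd q n l ℚ.* (E ℚ.* inv D) ℚ.* D
    ≡⟨ solve 4 (λ p e i d → p :* (e :* i) :* d := (p :* e) :* (i :* d)) refl (gbProd q n l) E (inv D) D ⟩
  gbProd q n l ℚ.* E ℚ.* (inv D ℚ.* D)
    ≡⟨ cong (gbProd q n l ℚ.* E ℚ.*_) (inv-inverseˡ D D≢0) ⟩
  gbProd q n l ℚ.* E ℚ.* 1ℚ
    ≡⟨ ℚP.*-identityʳ _ ⟩
  gbProd q n l ℚ.* E
    ≡⟨ cong₂ ℚ._*_ (sym (gbin≡gbProd q n l (ℕP.<⇒≤ l<n))) (cong (δ q) n∸[1+l]+1≡n∸l) ⟩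
  gbin q n l ℚ.* δ q (n ℕ.∸ l) ∎
  where
  open ≡-Reasoning
  D = δ q (suc l)
  E = δ q (n ℕ.∸ suc l ℕ.+ 1)
  n∸[1+l]+1≡n∸l : n ℕ.∸ suc l ℕ.+ 1 ≡ n ℕ.∸ l
  n∸[1+l]+1≡n∸l = trans (ℕP.+-comm (n ℕ.∸ suc l) 1) (sym (ℕP.+-∸-assoc 1 l<n))

suc-C2 : ∀ t → suc t C 2 ≡ t ℕ.+ t C 2
suc-C2 t = trans (sym (nCk+nC[k+1]≡[n+1]C[k+1] t 1)) (cong (ℕ._+ t C 2) (nC1≡n t))

T-exponent-step : ∀ g j d → g ℕ.< j → j ℕ.≤ d →
  (j ℕ.∸ g) C 2 ℕ.+ g ℕ.* d ℕ.+ (d ℕ.∸ j ℕ.+ suc g) ≡ (j ℕ.∸ suc g) C 2 ℕ.+ suc g ℕ.* d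
T-exponent-step g j d g<j j≤d with ℕP.m≤n⇒∃[o]m+o≡n g<j | ℕP.m≤n⇒∃[o]m+o≡n j≤d
... | t , refl | w , refl = begin
    (suc g ℕ.+ t ℕ.∸ g) C 2 ℕ.+ g ℕ.* d ℕ.+ (d ℕ.∸ (suc g ℕ.+ t) ℕ.+ suc g)
      ≡⟨ cong₂ (λ x y → x C 2 ℕ.+ g ℕ.* d ℕ.+ (y ℕ.+ suc g))
           (trans (cong (ℕ._∸ g) (sym (ℕP.+-suc g t))) (ℕP.m+n∸m≡n g (suc t)))
           (ℕP.m+n∸m≡n (suc g ℕ.+ t) w) ⟩
    suc t C 2 ℕ.+ g ℕ.* d ℕ.+ (w ℕ.+ suc g)
      ≡⟨ cong (λ x → x ℕ.+ g ℕ.* d ℕ.+ (w ℕ.+ suc g)) (suc-C2 t) ⟩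
    t ℕ.+ t C 2 ℕ.+ g ℕ.* d ℕ.+ (w ℕ.+ suc g)
      ≡⟨ ring-identity t (t C 2) g w ⟩
    t C 2 ℕ.+ suc g ℕ.* d
      ≡⟨ cong (λ x → x C 2 ℕ.+ suc g ℕ.* d) (sym (ℕP.m+n∸m≡n (suc g) t)) ⟩
    (suc g ℕ.+ t ℕ.∸ suc g) C 2 ℕ.+ suc g ℕ.* d ∎
  where
  open ≡-Reasoning
  ring-identity : ∀ t c g w → t ℕ.+ c ℕ.+ g ℕ.* (suc g ℕ.+ t ℕ.+ w) ℕ.+ (w ℕ.+ suc g)
                   ≡ c ℕ.+ suc g ℕ.* (suc g ℕ.+ t ℕ.+ w)
  ring-identity = solve-∀

m∸n≡1+m∸[1+n] : ∀ {m n} → n ℕ.< m → m ℕ.∸ n ≡ suc (m ℕ.∸ suc n)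
m∸n≡1+m∸[1+n] {suc m} {zero} _ = refl
m∸n≡1+m∸[1+n] {suc m} {suc n} (s≤s n<m) = m∸n≡1+m∸[1+n] n<m

[m∸n]∸[m∸o]≡o∸n : ∀ {m n o} → n ℕ.≤ o → o ℕ.≤ m → (m ℕ.∸ n) ℕ.∸ (m ℕ.∸ o) ≡ o ℕ.∸ n
[m∸n]∸[m∸o]≡o∸n {n = n} {o} n≤o o≤m with ℕP.m≤n⇒∃[o]m+o≡n o≤m
... | w , refl = begin
  (o ℕ.+ w ℕ.∸ n) ℕ.∸ (o ℕ.+ w ℕ.∸ o) ≡⟨ cong₂ ℕ._∸_ (ℕP.+-∸-comm w n≤o) (ℕP.m+n∸m≡n o w) ⟩
  (o ℕ.∸ n ℕ.+ w) ℕ.∸ w              ≡⟨ ℕP.m+n∸n≡m (o ℕ.∸ n) w ⟩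
  o ℕ.∸ n ∎
  where open ≡-Reasoning

T-ratio : ∀ q d i j g → g ℕ.< j → j ℕ.≤ d → g ℕ.< d ℕ.∸ i → δ q (suc g) ≢ 0ℚ →
  T q d g i j ℚ.* (bpow q (d ℕ.∸ j ℕ.+ suc g) ℚ.* (δ q (j ℕ.∸ g) ℚ.* δ q (d ℕ.∸ i ℕ.∸ g)))
  ≡ T q d (suc g) i j ℚ.* (δ q (d ℕ.∸ g) ℚ.* δ q (suc g))
T-ratio q d i j g g<j j≤d g<r δ≢0 = begin
    s ℚ.* P ℚ.* G ℚ.* N ℚ.* (B ℚ.* (δ q (j ℕ.∸ g) ℚ.* δ q (d ℕ.∸ i ℕ.∸ g)))
      ≡⟨ solve 7 (λ s p g n b u e → s :* p :* g :* n :* (b :* (u :* e))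
                   := s :* (p :* b) :* (g :* u) :* (n :* e)) refl s P G N B _ _ ⟩
    s ℚ.* (P ℚ.* B) ℚ.* (G ℚ.* δ q (j ℕ.∸ g)) ℚ.* (N ℚ.* δ q (d ℕ.∸ i ℕ.∸ g))
      ≡⟨ cong₂ (λ x y → s ℚ.* x ℚ.* y ℚ.* (N ℚ.* δ q (d ℕ.∸ i ℕ.∸ g))) power-step binom-upper ⟩
    s ℚ.* P′ ℚ.* (G′ ℚ.* δ q (d ℕ.∸ g)) ℚ.* (N ℚ.* δ q (d ℕ.∸ i ℕ.∸ g))
      ≡⟨ cong (λ x → s ℚ.* P′ ℚ.* (G′ ℚ.* δ q (d ℕ.∸ g)) ℚ.* x)
              (sym (gbin-suc-lower q (d ℕ.∸ i) g g<r δ≢0)) ⟩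
    s ℚ.* P′ ℚ.* (G′ ℚ.* δ q (d ℕ.∸ g)) ℚ.* (N′ ℚ.* δ q (suc g))
      ≡⟨ solve 6 (λ s p g a n h → s :* p :* (g :* a) :* (n :* h)
                   := s :* p :* g :* n :* (a :* h)) refl s P′ G′ _ N′ _ ⟩
    s ℚ.* P′ ℚ.* G′ ℚ.* N′ ℚ.* (δ q (d ℕ.∸ g) ℚ.* δ q (suc g)) ∎
  where
  open ≡-Reasoning
  s = sgnPow j
  P = bpow q ((j ℕ.∸ g) C 2 ℕ.+ g ℕ.* d)
  P′ = bpow q ((j ℕ.∸ suc g) C 2 ℕ.+ suc g ℕ.* d)
  B = bpow q (d ℕ.∸ j ℕ.+ suc g)
  G = gbin q (d ℕ.∸ g) (d ℕ.∸ j)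
  G′ = gbin q (d ℕ.∸ suc g) (d ℕ.∸ j)
  N = gbin q (d ℕ.∸ i) g
  N′ = gbin q (d ℕ.∸ i) (suc g)
  g<d = ℕP.<-≤-trans g<j j≤d
  power-step : P ℚ.* B ≡ P′
  power-step = trans (sym (bpow-+ q ((j ℕ.∸ g) C 2 ℕ.+ g ℕ.* d) (d ℕ.∸ j ℕ.+ suc g)))
    (cong (bpow q) (T-exponent-step g j d g<j j≤d))
  binom-upper : G ℚ.* δ q (j ℕ.∸ g) ≡ G′ ℚ.* δ q (d ℕ.∸ g)
  binom-upper = begin
    G ℚ.* δ q (j ℕ.∸ g)
      ≡⟨ cong (G ℚ.*_) (cong (δ q) (sym ([m∸n]∸[m∸o]≡o∸n (ℕP.<⇒≤ g<j) j≤d))) ⟩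
    G ℚ.* δ q (d ℕ.∸ g ℕ.∸ (d ℕ.∸ j))
      ≡⟨ cong (λ m → gbin q m (d ℕ.∸ j) ℚ.* δ q (m ℕ.∸ (d ℕ.∸ j))) (m∸n≡1+m∸[1+n] g<d) ⟩
    gbin q (suc (d ℕ.∸ suc g)) (d ℕ.∸ j) ℚ.* δ q (suc (d ℕ.∸ suc g) ℕ.∸ (d ℕ.∸ j))
      ≡⟨ gbin-suc-upper q (d ℕ.∸ suc g) (d ℕ.∸ j) (ℕP.∸-monoʳ-≤ d g<j) ⟩
    G′ ℚ.* δ q (suc (d ℕ.∸ suc g))
      ≡⟨ cong (λ m → G′ ℚ.* δ q m) (sym (m∸n≡1+m∸[1+n] g<d)) ⟩
    G′ ℚ.* δ q (d ℕ.∸ g) ∎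

-- The size of b ^ n - 1

μ : ℕ → ℕ → ℕ
μ q n = ℤ.∣ (ℤ.- + q) ℤ.^ n ℤ.- + 1 ∣

abs-^ : ∀ i n → ℤ.∣ i ℤ.^ n ∣ ≡ ℤ.∣ i ∣ ℕ.^ n
abs-^ i zero = refl
abs-^ i (suc n) = trans (ℤP.abs-* i (i ℤ.^ n)) (cong (ℤ.∣ i ∣ ℕ.*_) (abs-^ i n))

pos-^ : ∀ m n → + (m ℕ.^ n) ≡ (+ m) ℤ.^ n
pos-^ m zero = refl
pos-^ m (suc n) = trans (ℤP.pos-* m (m ℕ.^ n)) (cong (+ m ℤ.*_) (pos-^ m n))

neg-^-even : ∀ i k → (ℤ.- i) ℤ.^ (2 ℕ.* k) ≡ i ℤ.^ (2 ℕ.* k)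
neg-^-even i k = begin
  (ℤ.- i) ℤ.^ (2 ℕ.* k)   ≡⟨ sym (ℤP.^-*-assoc (ℤ.- i) 2 k) ⟩
  ((ℤ.- i) ℤ.^ 2) ℤ.^ k   ≡⟨ cong (ℤ._^ k) square ⟩
  (i ℤ.^ 2) ℤ.^ k         ≡⟨ ℤP.^-*-assoc i 2 k ⟩
  i ℤ.^ (2 ℕ.* k) ∎
  where
  open ≡-Reasoning
  square : (ℤ.- i) ℤ.^ 2 ≡ i ℤ.^ 2
  square = begin
    ℤ.- i ℤ.* (ℤ.- i ℤ.* + 1) ≡⟨ cong (ℤ.- i ℤ.*_) (ℤP.*-identityʳ (ℤ.- i)) ⟩
    ℤ.- i ℤ.* ℤ.- i           ≡⟨ sym (ℤP.neg-distribˡ-* i (ℤ.- i)) ⟩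
    ℤ.- (i ℤ.* ℤ.- i)         ≡⟨ cong ℤ.-_ (sym (ℤP.neg-distribʳ-* i i)) ⟩
    ℤ.- ℤ.- (i ℤ.* i)         ≡⟨ ℤP.neg-involutive (i ℤ.* i) ⟩
    i ℤ.* i                   ≡⟨ cong (i ℤ.*_) (sym (ℤP.*-identityʳ i)) ⟩
    i ℤ.* (i ℤ.* + 1) ∎

∣[-q]^n∣ : ∀ q n → ℤ.∣ (ℤ.- + q) ℤ.^ n ∣ ≡ q ℕ.^ n
∣[-q]^n∣ q n = trans (abs-^ (ℤ.- + q) n) (cong (ℕ._^ n) (ℤP.∣-i∣≡∣i∣ (+ q)))

∣bpow∣ : ∀ q n → ℚ.∣ bpow q n ∣ ≡ ι (+ (q ℕ.^ n))
∣bpow∣ q n = trans (ι-homo-∣∣ ((ℤ.- + q) ℤ.^ n)) (cong (λ k → ι (+ k)) (∣[-q]^n∣ q n))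

∣δ∣ : ∀ q n → ℚ.∣ δ q n ∣ ≡ ι (+ μ q n)
∣δ∣ q n = trans (cong ℚ.∣_∣ δ≡ι) (ι-homo-∣∣ ((ℤ.- + q) ℤ.^ n ℤ.- + 1))
  where
  δ≡ι : δ q n ≡ ι ((ℤ.- + q) ℤ.^ n ℤ.- + 1)
  δ≡ι = sym (trans (ι-homo-+ ((ℤ.- + q) ℤ.^ n) (ℤ.- + 1)) (cong (bpow q n ℚ.+_) (ι-homo‿- (+ 1))))

μ≤q^n+1 : ∀ q n → μ q n ℕ.≤ q ℕ.^ n ℕ.+ 1
μ≤q^n+1 q n = ℕP.≤-trans (ℤP.∣i-j∣≤∣i∣+∣j∣ ((ℤ.- + q) ℤ.^ n) (+ 1))
  (ℕP.≤-reflexive (cong (ℕ._+ 1) (∣[-q]^n∣ q n)))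

q^n≤μ+1 : ∀ q n → q ℕ.^ n ℕ.≤ μ q n ℕ.+ 1
q^n≤μ+1 q n = begin
  q ℕ.^ n                         ≡⟨ sym (∣[-q]^n∣ q n) ⟩
  ℤ.∣ x ∣                         ≡⟨ cong ℤ.∣_∣ (sym x-1+1≡x) ⟩
  ℤ.∣ (x ℤ.- + 1) ℤ.+ + 1 ∣       ≤⟨ ℤP.∣i+j∣≤∣i∣+∣j∣ (x ℤ.- + 1) (+ 1) ⟩
  μ q n ℕ.+ 1 ∎
  where
  open ℕP.≤-Reasoning
  x = (ℤ.- + q) ℤ.^ n
  x-1+1≡x : (x ℤ.- + 1) ℤ.+ + 1 ≡ x
  x-1+1≡x = trans (ℤP.+-assoc x (ℤ.- + 1) (+ 1))
    (trans (cong (ℤ._+_ x) (ℤP.+-inverseˡ (+ 1))) (ℤP.+-identityʳ x))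

μ-even : ∀ q k → 1 ℕ.≤ q → μ q (2 ℕ.* k) ℕ.≤ q ℕ.^ (2 ℕ.* k)
μ-even q k 1≤q = subst (λ z → ℤ.∣ z ℤ.- + 1 ∣ ℕ.≤ q ℕ.^ (2 ℕ.* k))
    (sym (trans (neg-^-even (+ q) k) (sym (pos-^ q (2 ℕ.* k)))))
    (∣N-1∣≤N (ℕP.m^n>0 q {{ℕ.>-nonZero 1≤q}} (2 ℕ.* k)))
  where
  ∣N-1∣≤N : ∀ {N} → 1 ℕ.≤ N → ℤ.∣ + N ℤ.- + 1 ∣ ℕ.≤ N
  ∣N-1∣≤N {suc N} _ = ℕP.n≤1+n N

μ-one : ∀ q → μ q 1 ≡ q ℕ.+ 1
μ-one q = begin
  ℤ.∣ ℤ.- + q ℤ.* + 1 ℤ.- + 1 ∣ ≡⟨ cong (λ z → ℤ.∣ z ℤ.- + 1 ∣) (ℤP.*-identityʳ (ℤ.- + q)) ⟩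
  ℤ.∣ ℤ.- + q ℤ.+ ℤ.- + 1 ∣     ≡⟨ cong ℤ.∣_∣ (sym (ℤP.neg-distrib-+ (+ q) (+ 1))) ⟩
  ℤ.∣ ℤ.- (+ q ℤ.+ + 1) ∣       ≡⟨ ℤP.∣-i∣≡∣i∣ (+ q ℤ.+ + 1) ⟩
  ℤ.∣ + q ℤ.+ + 1 ∣             ≡⟨ cong ℤ.∣_∣ (sym (ℤP.pos-+ q 1)) ⟩
  q ℕ.+ 1 ∎
  where open ≡-Reasoning

q+1≤μ : ∀ q n → 2 ℕ.≤ q → 1 ℕ.≤ n → q ℕ.+ 1 ℕ.≤ μ q n
q+1≤μ q (suc zero) _ _ = ℕP.≤-reflexive (sym (μ-one q))
q+1≤μ q (suc (suc n)) 2≤q _ = ℕP.+-cancelʳ-≤ 1 (q ℕ.+ 1) (μ q (2 ℕ.+ n)) (begin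
  q ℕ.+ 1 ℕ.+ 1    ≤⟨ ℕP.≤-reflexive (ℕP.+-assoc q 1 1) ⟩
  q ℕ.+ 2          ≤⟨ ℕP.+-monoʳ-≤ q 2≤q ⟩
  q ℕ.+ q          ≡⟨ cong (q ℕ.+_) (sym (ℕP.+-identityʳ q)) ⟩
  2 ℕ.* q          ≤⟨ ℕP.*-monoˡ-≤ q 2≤q ⟩
  q ℕ.* q          ≡⟨ cong (q ℕ.*_) (sym (ℕP.*-identityʳ q)) ⟩
  q ℕ.^ 2          ≤⟨ ℕP.^-monoʳ-≤ q {{ℕ.>-nonZero (ℕP.<-trans (s≤s z≤n) 2≤q)}} (ℕP.m≤m+n 2 n) ⟩
  q ℕ.^ (2 ℕ.+ n)  ≤⟨ q^n≤μ+1 q (2 ℕ.+ n) ⟩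
  μ q (2 ℕ.+ n) ℕ.+ 1 ∎)
  where open ℕP.≤-Reasoning

1≤μ : ∀ {q n} → 2 ℕ.≤ q → 1 ℕ.≤ n → 1 ℕ.≤ μ q n
1≤μ {q} {n} 2≤q 1≤n = ℕP.≤-trans (ℕP.m≤n+m 1 q) (q+1≤μ q n 2≤q 1≤n)

3≤μ : ∀ {q e} → 2 ℕ.≤ q → 1 ℕ.≤ e → 3 ℕ.≤ μ q e
3≤μ {q} {e} 2≤q 1≤e = ℕP.≤-trans (ℕP.+-monoˡ-≤ 1 2≤q) (q+1≤μ q e 2≤q 1≤e)

-- Bounding the ratio of consecutive terms

record RatioBelow (q n N M : ℕ) : Set where
  constructor ratio≤
  field cross : μ q n ℕ.* M ℕ.≤ N ℕ.* q ℕ.^ n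

record RatioAbove (q n N M : ℕ) : Set where
  constructor ratio≥
  field cross : N ℕ.* q ℕ.^ n ℕ.≤ μ q n ℕ.* M

record PairBelow (q a h N M : ℕ) : Set where
  constructor pair≤
  field cross : μ q a ℕ.* μ q h ℕ.* M ℕ.≤ N ℕ.* (q ℕ.^ a ℕ.* q ℕ.^ h)

p^t≤q^n : ∀ {p q t n} → 1 ℕ.≤ p → p ℕ.≤ q → t ℕ.≤ n → p ℕ.^ t ℕ.≤ q ℕ.^ n
p^t≤q^n {suc p} {q} {t} {n} _ p≤q t≤n =
  ℕP.≤-trans (ℕP.^-monoʳ-≤ (suc p) t≤n) (ℕP.^-monoˡ-≤ n p≤q)

ratio-below : ∀ {p q t n} → 1 ℕ.≤ p → p ℕ.≤ q → t ℕ.≤ n →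
  RatioBelow q n (p ℕ.^ t ℕ.+ 1) (p ℕ.^ t)
ratio-below {p} {q} {t} {n} 1≤p p≤q t≤n = ratio≤ (begin
  μ q n ℕ.* pᵗ        ≤⟨ ℕP.*-monoˡ-≤ pᵗ (μ≤q^n+1 q n) ⟩
  (qⁿ ℕ.+ 1) ℕ.* pᵗ   ≡⟨ expand qⁿ pᵗ ⟩
  pᵗ ℕ.* qⁿ ℕ.+ pᵗ    ≤⟨ ℕP.+-monoʳ-≤ (pᵗ ℕ.* qⁿ) (p^t≤q^n 1≤p p≤q t≤n) ⟩
  pᵗ ℕ.* qⁿ ℕ.+ qⁿ    ≡⟨ collect pᵗ qⁿ ⟩
  (pᵗ ℕ.+ 1) ℕ.* qⁿ ∎)
  where
  open ℕP.≤-Reasoning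
  pᵗ = p ℕ.^ t
  qⁿ = q ℕ.^ n
  expand : ∀ x y → (x ℕ.+ 1) ℕ.* y ≡ y ℕ.* x ℕ.+ y
  expand = solve-∀
  collect : ∀ x y → x ℕ.* y ℕ.+ y ≡ (x ℕ.+ 1) ℕ.* y
  collect = solve-∀

ratio-below-odd : ∀ {p q n} k → 1 ℕ.≤ p → p ℕ.≤ q → 2 ℕ.* k ℕ.≤ n →
  RatioBelow q n (p ℕ.^ suc (2 ℕ.* k) ℕ.+ 1) (p ℕ.^ suc (2 ℕ.* k))
ratio-below-odd {p} {q} {n} k 1≤p p≤q 2k≤n with ℕP.m≤n⇒m<n∨m≡n 2k≤n
... | inj₁ 2k<n = ratio-below 1≤p p≤q 2k<n
... | inj₂ refl = ratio≤ (begin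
  μ q n ℕ.* pᵗ         ≤⟨ ℕP.*-monoˡ-≤ pᵗ (μ-even q k (ℕP.≤-trans 1≤p p≤q)) ⟩
  q ℕ.^ n ℕ.* pᵗ       ≡⟨ ℕP.*-comm (q ℕ.^ n) pᵗ ⟩
  pᵗ ℕ.* q ℕ.^ n       ≤⟨ ℕP.*-monoˡ-≤ (q ℕ.^ n) (ℕP.n≤1+n pᵗ) ⟩
  suc pᵗ ℕ.* q ℕ.^ n   ≡⟨ cong (ℕ._* q ℕ.^ n) (ℕP.+-comm 1 pᵗ) ⟩
  (pᵗ ℕ.+ 1) ℕ.* q ℕ.^ n ∎)
  where
  open ℕP.≤-Reasoning
  pᵗ = p ℕ.^ suc (2 ℕ.* k)

ratio-above : ∀ {p q t n} → 1 ℕ.≤ p → p ℕ.≤ q → t ℕ.≤ n →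
  RatioAbove q n (p ℕ.^ t ℕ.∸ 1) (p ℕ.^ t)
ratio-above {p} {q} {t} {n} 1≤p p≤q t≤n = ratio≥ (begin
  (pᵗ ℕ.∸ 1) ℕ.* qⁿ     ≡⟨ ℕP.*-distribʳ-∸ qⁿ pᵗ 1 ⟩
  pᵗ ℕ.* qⁿ ℕ.∸ 1 ℕ.* qⁿ ≡⟨ cong (pᵗ ℕ.* qⁿ ℕ.∸_) (ℕP.*-identityˡ qⁿ) ⟩
  pᵗ ℕ.* qⁿ ℕ.∸ qⁿ       ≤⟨ ℕP.m≤n+o⇒m∸n≤o (pᵗ ℕ.* qⁿ) qⁿ pᵗqⁿ≤qⁿ+μpᵗ ⟩
  μ q n ℕ.* pᵗ ∎)
  where
  open ℕP.≤-Reasoning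
  pᵗ = p ℕ.^ t
  qⁿ = q ℕ.^ n
  pᵗqⁿ≤qⁿ+μpᵗ : pᵗ ℕ.* qⁿ ℕ.≤ qⁿ ℕ.+ μ q n ℕ.* pᵗ
  pᵗqⁿ≤qⁿ+μpᵗ = begin
    pᵗ ℕ.* qⁿ                 ≤⟨ ℕP.*-monoʳ-≤ pᵗ (q^n≤μ+1 q n) ⟩
    pᵗ ℕ.* (μ q n ℕ.+ 1)     ≡⟨ identity pᵗ (μ q n) ⟩
    pᵗ ℕ.+ μ q n ℕ.* pᵗ       ≤⟨ ℕP.+-monoˡ-≤ (μ q n ℕ.* pᵗ) (p^t≤q^n 1≤p p≤q t≤n) ⟩
    qⁿ ℕ.+ μ q n ℕ.* pᵗ ∎
    where
    identity : ∀ x y → x ℕ.* (y ℕ.+ 1) ≡ x ℕ.+ y ℕ.* x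
    identity = solve-∀

ratio-above-one-exact : ∀ q → RatioAbove q 1 (q ℕ.+ 1) q
ratio-above-one-exact q = ratio≥ (ℕP.≤-reflexive (begin
  (q ℕ.+ 1) ℕ.* q ℕ.^ 1 ≡⟨ cong ((q ℕ.+ 1) ℕ.*_) (ℕP.*-identityʳ q) ⟩
  (q ℕ.+ 1) ℕ.* q       ≡⟨ cong (ℕ._* q) (sym (μ-one q)) ⟩
  μ q 1 ℕ.* q ∎))
  where open ≡-Reasoning

ratio-above-one : ∀ q → RatioAbove q 1 1 1
ratio-above-one q = ratio≥ (begin
  1 ℕ.* q ℕ.^ 1  ≡⟨ trans (ℕP.*-identityˡ (q ℕ.^ 1)) (ℕP.*-identityʳ q) ⟩
  q              ≤⟨ ℕP.m≤m+n q 1 ⟩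
  q ℕ.+ 1        ≡⟨ sym (trans (ℕP.*-identityʳ (μ q 1)) (μ-one q)) ⟩
  μ q 1 ℕ.* 1 ∎)
  where open ℕP.≤-Reasoning

p^t∸1≤μ : ∀ {p q t n} → 1 ℕ.≤ p → p ℕ.≤ q → t ℕ.≤ n → p ℕ.^ t ℕ.∸ 1 ℕ.≤ μ q n
p^t∸1≤μ {q = q} {n = n} 1≤p p≤q t≤n = ℕP.m≤n+o⇒m∸n≤o _ 1
  (ℕP.≤-trans (p^t≤q^n 1≤p p≤q t≤n) (ℕP.≤-trans (q^n≤μ+1 q n) (ℕP.≤-reflexive (ℕP.+-comm (μ q n) 1))))

ratio-below-* : ∀ {q a h Na Ma Nh Mh} → RatioBelow q a Na Ma → RatioBelow q h Nh Mh →
  PairBelow q a h (Na ℕ.* Nh) (Ma ℕ.* Mh)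
ratio-below-* {q} {a} {h} {Na} {Ma} {Nh} {Mh} (ratio≤ ra) (ratio≤ rh) = pair≤ (begin
  μ q a ℕ.* μ q h ℕ.* (Ma ℕ.* Mh)         ≡⟨ interchange (μ q a) (μ q h) Ma Mh ⟩
  (μ q a ℕ.* Ma) ℕ.* (μ q h ℕ.* Mh)       ≤⟨ ℕP.*-mono-≤ ra rh ⟩
  (Na ℕ.* q ℕ.^ a) ℕ.* (Nh ℕ.* q ℕ.^ h)   ≡⟨ interchange Na (q ℕ.^ a) Nh (q ℕ.^ h) ⟩
  Na ℕ.* Nh ℕ.* (q ℕ.^ a ℕ.* q ℕ.^ h) ∎)
  where
  open ℕP.≤-Reasoning
  interchange : ∀ x y z w → x ℕ.* y ℕ.* (z ℕ.* w) ≡ (x ℕ.* z) ℕ.* (y ℕ.* w)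
  interchange = solve-∀

-- One of a, h is at least 4 and the other at least 2; ratio-below-odd turns these into exponents 5 and 3.
pair-below : ∀ {p q a h} → 1 ℕ.≤ p → p ℕ.≤ q → 2 ℕ.≤ a → 2 ℕ.≤ h → 7 ℕ.≤ a ℕ.+ h →
  PairBelow q a h ((p ℕ.^ 3 ℕ.+ 1) ℕ.* (p ℕ.^ 5 ℕ.+ 1)) (p ℕ.^ 3 ℕ.* p ℕ.^ 5)
pair-below {p} {q} {a} {h} 1≤p p≤q 2≤a 2≤h 7≤a+h with a ℕ.≤? 3
... | yes a≤3 = ratio-below-* (ratio-below-odd 1 1≤p p≤q 2≤a) (ratio-below-odd 2 1≤p p≤q 4≤h)
  where
  4≤h : 4 ℕ.≤ h
  4≤h = ℕP.+-cancelˡ-≤ 3 4 h (ℕP.≤-trans 7≤a+h (ℕP.+-monoˡ-≤ h a≤3))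
... | no a≰3 = subst₂ (PairBelow q a h) (ℕP.*-comm (p ℕ.^ 5 ℕ.+ 1) (p ℕ.^ 3 ℕ.+ 1)) (ℕP.*-comm (p ℕ.^ 5) (p ℕ.^ 3))
  (ratio-below-* (ratio-below-odd 2 1≤p p≤q (ℕP.≰⇒> a≰3)) (ratio-below-odd 1 1≤p p≤q 2≤h))

-- As D + u = a + h, the quotient μ a μ h / (q ^ D μ u μ e) factors as
-- (μ a μ h / q ^ a q ^ h) · (q ^ u / μ u) · (1 / μ e).
step-ratio-bound : ∀ {q a h u e D N M Nu Mu Ne} cn cd →
  PairBelow q a h N M → RatioAbove q u Nu Mu → Ne ℕ.≤ μ q e → D ℕ.+ u ≡ a ℕ.+ h →
  cd ℕ.* N ℕ.* Mu ℕ.≤ cn ℕ.* (M ℕ.* Nu ℕ.* Ne) → .{{_ : ℕ.NonZero (M ℕ.* Nu ℕ.* Ne)}} →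
  cd ℕ.* (μ q a ℕ.* μ q h) ℕ.≤ cn ℕ.* (q ℕ.^ D ℕ.* (μ q u ℕ.* μ q e))
step-ratio-bound {q} {a} {h} {u} {e} {D} {N} {M} {Nu} {Mu} {Ne} cn cd (pair≤ pair) (ratio≥ above) below D+u≡a+h check =
  ℕP.*-cancelʳ-≤ _ _ K (begin
    cd ℕ.* (μ q a ℕ.* μ q h) ℕ.* K
      ≡⟨ shuffle₁ cd (μ q a) (μ q h) M Nu Ne ⟩
    cd ℕ.* (μ q a ℕ.* μ q h ℕ.* M) ℕ.* (Nu ℕ.* Ne)
      ≤⟨ ℕP.*-monoˡ-≤ (Nu ℕ.* Ne) (ℕP.*-monoʳ-≤ cd pair) ⟩
    cd ℕ.* (N ℕ.* (q ℕ.^ a ℕ.* q ℕ.^ h)) ℕ.* (Nu ℕ.* Ne)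
      ≡⟨ cong (λ z → cd ℕ.* (N ℕ.* z) ℕ.* (Nu ℕ.* Ne)) q^D*q^u≡q^a*q^h ⟨
    cd ℕ.* (N ℕ.* (q ℕ.^ D ℕ.* q ℕ.^ u)) ℕ.* (Nu ℕ.* Ne)
      ≡⟨ shuffle₂ cd N (q ℕ.^ D) (q ℕ.^ u) Nu Ne ⟩
    cd ℕ.* N ℕ.* q ℕ.^ D ℕ.* (Nu ℕ.* q ℕ.^ u) ℕ.* Ne
      ≤⟨ ℕP.*-mono-≤ (ℕP.*-monoʳ-≤ (cd ℕ.* N ℕ.* q ℕ.^ D) above) below ⟩
    cd ℕ.* N ℕ.* q ℕ.^ D ℕ.* (μ q u ℕ.* Mu) ℕ.* μ q e
      ≡⟨ shuffle₃ cd N (q ℕ.^ D) (μ q u) Mu (μ q e) ⟩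
    cd ℕ.* N ℕ.* Mu ℕ.* X
      ≤⟨ ℕP.*-monoˡ-≤ X check ⟩
    cn ℕ.* K ℕ.* X
      ≡⟨ shuffle₄ cn K X ⟩
    cn ℕ.* X ℕ.* K ∎)
  where
  open ℕP.≤-Reasoning
  K = M ℕ.* Nu ℕ.* Ne
  X = q ℕ.^ D ℕ.* (μ q u ℕ.* μ q e)
  q^D*q^u≡q^a*q^h : q ℕ.^ D ℕ.* q ℕ.^ u ≡ q ℕ.^ a ℕ.* q ℕ.^ h
  q^D*q^u≡q^a*q^h = trans (sym (ℕP.^-distribˡ-+-* q D u))
    (trans (cong (q ℕ.^_) D+u≡a+h) (ℕP.^-distribˡ-+-* q a h))
  shuffle₁ : ∀ c x y m n e → c ℕ.* (x ℕ.* y) ℕ.* (m ℕ.* n ℕ.* e) ≡ c ℕ.* (x ℕ.* y ℕ.* m) ℕ.* (n ℕ.* e)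
  shuffle₁ = solve-∀
  shuffle₂ : ∀ c n x y m e → c ℕ.* (n ℕ.* (x ℕ.* y)) ℕ.* (m ℕ.* e) ≡ c ℕ.* n ℕ.* x ℕ.* (m ℕ.* y) ℕ.* e
  shuffle₂ = solve-∀
  shuffle₃ : ∀ c n x y m z → c ℕ.* n ℕ.* x ℕ.* (y ℕ.* m) ℕ.* z ≡ c ℕ.* n ℕ.* m ℕ.* (x ℕ.* (y ℕ.* z))
  shuffle₃ = solve-∀
  shuffle₄ : ∀ c k x → c ℕ.* k ℕ.* x ≡ c ℕ.* x ℕ.* k
  shuffle₄ = solve-∀

q≡2⊎3≤q : ∀ {q} → 2 ℕ.≤ q → q ≡ 2 ⊎ 3 ℕ.≤ q
q≡2⊎3≤q {suc zero} (s≤s ())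
q≡2⊎3≤q {suc (suc zero)} _ = inj₁ refl
q≡2⊎3≤q {suc (suc (suc _))} _ = inj₂ (s≤s (s≤s (s≤s z≤n)))

≤-by-computation : ∀ {m n} → True (m ℕ.≤? n) → m ℕ.≤ n
≤-by-computation = toWitness

≤ℚ-by-computation : ∀ {p q} → True (p ℚP.≤? q) → p ℚ.≤ q
≤ℚ-by-computation = toWitness

<ℚ-by-computation : ∀ {p q} → True (p ℚP.<? q) → p ℚ.< q
<ℚ-by-computation = toWitness

step-bound-u≡1 : ∀ {q a h u e D} → 2 ℕ.≤ q → 2 ℕ.≤ a → 2 ℕ.≤ h → 7 ℕ.≤ a ℕ.+ h → u ≡ 1 → 1 ℕ.≤ e →
  D ℕ.+ u ≡ a ℕ.+ h → 15 ℕ.* (μ q a ℕ.* μ q h) ℕ.≤ 4 ℕ.* (q ℕ.^ D ℕ.* (μ q u ℕ.* μ q e))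
-- The uniform bound μ q 1 / q ≥ 1 is too weak at q = 2, where μ 2 1 / 2 = 3/2 is used instead;
-- for q ≥ 3 the other factors are bounded with p = 3.
step-bound-u≡1 {q} {a} {h} {e = e} {D} 2≤q 2≤a 2≤h 7≤a+h refl 1≤e D+1≡a+h with q≡2⊎3≤q 2≤q
... | inj₁ refl =
  step-ratio-bound {q} {a} {h} {1} {e} {D} 4 15 (pair-below {p = 2} (s≤s z≤n) 2≤q 2≤a 2≤h 7≤a+h)
    (ratio-above-one-exact q) (3≤μ {q} {e} 2≤q 1≤e) D+1≡a+h (≤-by-computation tt)
... | inj₂ 3≤q =
  step-ratio-bound {q} {a} {h} {1} {e} {D} 4 15 (pair-below {p = 3} (s≤s z≤n) 3≤q 2≤a 2≤h 7≤a+h)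
    (ratio-above-one q) (ℕP.≤-trans (ℕP.+-monoˡ-≤ 1 3≤q) (q+1≤μ q e 2≤q 1≤e)) D+1≡a+h (≤-by-computation tt)

step-bound-u≥2 : ∀ {q a h u e D} → 2 ℕ.≤ q → 2 ℕ.≤ a → 2 ℕ.≤ h → 7 ℕ.≤ a ℕ.+ h → 2 ℕ.≤ u → 1 ℕ.≤ e →
  D ℕ.+ u ≡ a ℕ.+ h → 25 ℕ.* (μ q a ℕ.* μ q h) ℕ.≤ 13 ℕ.* (q ℕ.^ D ℕ.* (μ q u ℕ.* μ q e))
step-bound-u≥2 {q} {a} {h} {u} {e} {D} 2≤q 2≤a 2≤h 7≤a+h 2≤u 1≤e D+u≡a+h =
  step-ratio-bound {q} {a} {h} {u} {e} {D} 13 25 (pair-below {p = 2} (s≤s z≤n) 2≤q 2≤a 2≤h 7≤a+h)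
    (ratio-above {p = 2} (s≤s z≤n) 2≤q 2≤u) (3≤μ {q} {e} 2≤q 1≤e) D+u≡a+h (≤-by-computation tt)

step-bound-u≥3 : ∀ {q a h u e D} → 2 ℕ.≤ q → 2 ℕ.≤ a → 2 ℕ.≤ h → 7 ℕ.≤ a ℕ.+ h → 3 ℕ.≤ u → 1 ℕ.≤ e →
  D ℕ.+ u ≡ a ℕ.+ h → 20 ℕ.* (μ q a ℕ.* μ q h) ℕ.≤ 9 ℕ.* (q ℕ.^ D ℕ.* (μ q u ℕ.* μ q e))
step-bound-u≥3 {q} {a} {h} {u} {e} {D} 2≤q 2≤a 2≤h 7≤a+h 3≤u 1≤e D+u≡a+h =
  step-ratio-bound {q} {a} {h} {u} {e} {D} 9 20 (pair-below {p = 2} (s≤s z≤n) 2≤q 2≤a 2≤h 7≤a+h)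
    (ratio-above {p = 2} (s≤s z≤n) 2≤q 3≤u) (3≤μ {q} {e} 2≤q 1≤e) D+u≡a+h (≤-by-computation tt)

step-bound-e≥3 : ∀ {q a h u e D} → 2 ℕ.≤ q → 4 ℕ.≤ a → 2 ℕ.≤ u → 3 ℕ.≤ e →
  D ℕ.+ u ≡ a ℕ.+ h → 10 ℕ.* (μ q a ℕ.* μ q h) ℕ.≤ 3 ℕ.* (q ℕ.^ D ℕ.* (μ q u ℕ.* μ q e))
step-bound-e≥3 {q} {a} {h} {u} {e} {D} 2≤q 4≤a 2≤u 3≤e D+u≡a+h =
  step-ratio-bound {q} {a} {h} {u} {e} {D} 3 10
    (ratio-below-* (ratio-below-odd {2} 2 (s≤s z≤n) 2≤q 4≤a) (ratio-below-odd {2} {q} {h} 0 (s≤s z≤n) 2≤q z≤n))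
    (ratio-above {p = 2} (s≤s z≤n) 2≤q 2≤u) (p^t∸1≤μ {p = 2} {q} {3} {e} (s≤s z≤n) 2≤q 3≤e) D+u≡a+h (≤-by-computation tt)

δ≢0 : ∀ {q n} → 2 ℕ.≤ q → 1 ℕ.≤ n → δ q n ≢ 0ℚ
δ≢0 {q} {n} 2≤q 1≤n δ≡0 = ℚP.<-irrefl (sym ι[μ]≡0) (ι-pos (1≤μ 2≤q 1≤n))
  where
  ι[μ]≡0 : ι (+ μ q n) ≡ 0ℚ
  ι[μ]≡0 = trans (sym (∣δ∣ q n)) (cong ℚ.∣_∣ δ≡0)

∣T∣-ratio : ∀ q d i j g → 2 ℕ.≤ q → g ℕ.< j → j ℕ.≤ d → g ℕ.< d ℕ.∸ i →
  ℚ.∣ T q d g i j ∣ ℚ.* ι (+ (q ℕ.^ (d ℕ.∸ j ℕ.+ suc g) ℕ.* (μ q (j ℕ.∸ g) ℕ.* μ q (d ℕ.∸ i ℕ.∸ g))))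
  ≡ ℚ.∣ T q d (suc g) i j ∣ ℚ.* ι (+ (μ q (d ℕ.∸ g) ℕ.* μ q (suc g)))
∣T∣-ratio q d i j g 2≤q g<j j≤d g<r = begin
    ∣ T q d g i j ∣ ℚ.* ι (+ (q ℕ.^ D ℕ.* (μ q u ℕ.* μ q e)))
      ≡⟨ cong (∣ T q d g i j ∣ ℚ.*_) (trans (ιℕ-homo-* (q ℕ.^ D) (μ q u ℕ.* μ q e))
           (cong (ι (+ (q ℕ.^ D)) ℚ.*_) (ιℕ-homo-* (μ q u) (μ q e)))) ⟩
    ∣ T q d g i j ∣ ℚ.* (ι (+ (q ℕ.^ D)) ℚ.* (ι (+ μ q u) ℚ.* ι (+ μ q e)))
      ≡⟨ cong₂ (λ x y → ∣ T q d g i j ∣ ℚ.* (x ℚ.* y)) (∣bpow∣ q D) (cong₂ ℚ._*_ (∣δ∣ q u) (∣δ∣ q e)) ⟨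
    ∣ T q d g i j ∣ ℚ.* (∣ bpow q D ∣ ℚ.* (∣ δ q u ∣ ℚ.* ∣ δ q e ∣))
      ≡⟨ ∣xyz∣ (T q d g i j) (bpow q D) (δ q u) (δ q e) ⟨
    ∣ T q d g i j ℚ.* (bpow q D ℚ.* (δ q u ℚ.* δ q e)) ∣
      ≡⟨ cong ∣_∣ (T-ratio q d i j g g<j j≤d g<r (δ≢0 {q} {suc g} 2≤q (s≤s z≤n))) ⟩
    ∣ T q d (suc g) i j ℚ.* (δ q a ℚ.* δ q (suc g)) ∣
      ≡⟨ trans (ℚP.∣p*q∣≡∣p∣*∣q∣ (T q d (suc g) i j) (δ q a ℚ.* δ q (suc g)))
           (cong (∣ T q d (suc g) i j ∣ ℚ.*_) (ℚP.∣p*q∣≡∣p∣*∣q∣ (δ q a) (δ q (suc g)))) ⟩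
    ∣ T q d (suc g) i j ∣ ℚ.* (∣ δ q a ∣ ℚ.* ∣ δ q (suc g) ∣)
      ≡⟨ cong (∣ T q d (suc g) i j ∣ ℚ.*_) (trans (cong₂ ℚ._*_ (∣δ∣ q a) (∣δ∣ q (suc g))) (sym (ιℕ-homo-* (μ q a) (μ q (suc g))))) ⟩
    ∣ T q d (suc g) i j ∣ ℚ.* ι (+ (μ q a ℕ.* μ q (suc g))) ∎
  where
  open ≡-Reasoning
  D = d ℕ.∸ j ℕ.+ suc g
  u = j ℕ.∸ g
  e = d ℕ.∸ i ℕ.∸ g
  a = d ℕ.∸ g
  ∣xyz∣ : ∀ t x y z → ∣ t ℚ.* (x ℚ.* (y ℚ.* z)) ∣ ≡ ∣ t ∣ ℚ.* (∣ x ∣ ℚ.* (∣ y ∣ ℚ.* ∣ z ∣))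
  ∣xyz∣ t x y z = trans (ℚP.∣p*q∣≡∣p∣*∣q∣ t (x ℚ.* (y ℚ.* z))) (cong (∣ t ∣ ℚ.*_)
    (trans (ℚP.∣p*q∣≡∣p∣*∣q∣ x (y ℚ.* z)) (cong (∣ x ∣ ℚ.*_) (ℚP.∣p*q∣≡∣p∣*∣q∣ y z))))

≤-from-cross-multiplied : ∀ {x y : ℚ} {X Y : ℕ} (c : ℚ) cn cd → c ℚ.* ι (+ cd) ≡ ι (+ cn) →
  1 ℕ.≤ cd → 1 ℕ.≤ X → 0ℚ ℚ.≤ y → x ℚ.* ι (+ X) ≡ y ℚ.* ι (+ Y) → cd ℕ.* Y ℕ.≤ cn ℕ.* X →
  x ℚ.≤ c ℚ.* y
≤-from-cross-multiplied {x} {y} {X} {Y} c cn cd c*cd≡cn 1≤cd 1≤X 0≤y xX≡yY cdY≤cnX =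
  ℚP.*-cancelʳ-≤-pos K (begin
    x ℚ.* K                         ≡⟨ cong (x ℚ.*_) (ιℕ-homo-* cd X) ⟩
    x ℚ.* (ι⁺ cd ℚ.* ι⁺ X)          ≡⟨ solve 3 (λ x a b → x :* (a :* b) := a :* (x :* b)) refl x (ι⁺ cd) (ι⁺ X) ⟩
    ι⁺ cd ℚ.* (x ℚ.* ι⁺ X)          ≡⟨ cong (ι⁺ cd ℚ.*_) xX≡yY ⟩
    ι⁺ cd ℚ.* (y ℚ.* ι⁺ Y)          ≡⟨ solve 3 (λ y a b → a :* (y :* b) := y :* (a :* b)) refl y (ι⁺ cd) (ι⁺ Y) ⟩
    y ℚ.* (ι⁺ cd ℚ.* ι⁺ Y)          ≡⟨ cong (y ℚ.*_) (ιℕ-homo-* cd Y) ⟨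
    y ℚ.* ι⁺ (cd ℕ.* Y)             ≤⟨ ℚP.*-monoˡ-≤-nonNeg y (ι-mono-≤ (ℤ.+≤+ cdY≤cnX)) ⟩
    y ℚ.* ι⁺ (cn ℕ.* X)             ≡⟨ cong (y ℚ.*_) (trans (ιℕ-homo-* cn X) (cong (ℚ._* ι⁺ X) (sym c*cd≡cn))) ⟩
    y ℚ.* (c ℚ.* ι⁺ cd ℚ.* ι⁺ X)    ≡⟨ solve 4 (λ y c a b → y :* (c :* a :* b) := c :* y :* (a :* b)) refl y c (ι⁺ cd) (ι⁺ X) ⟩
    c ℚ.* y ℚ.* (ι⁺ cd ℚ.* ι⁺ X)    ≡⟨ cong (c ℚ.* y ℚ.*_) (ιℕ-homo-* cd X) ⟨
    c ℚ.* y ℚ.* K ∎)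
  where
  open ℚP.≤-Reasoning
  ι⁺ : ℕ → ℚ
  ι⁺ n = ι (+ n)
  K = ι⁺ (cd ℕ.* X)
  instance
    K-positive : ℚ.Positive K
    K-positive = ℚ.positive (ι-pos (ℕP.*-mono-≤ 1≤cd 1≤X))
    y-nonNegative : ℚ.NonNegative y
    y-nonNegative = ℚ.nonNegative 0≤y

∣T∣-step-bound : ∀ {q d i j g} (c : ℚ) cn cd → c ℚ.* ι (+ cd) ≡ ι (+ cn) → 1 ℕ.≤ cd →
  2 ℕ.≤ q → g ℕ.< j → j ℕ.≤ d → g ℕ.< d ℕ.∸ i →
  cd ℕ.* (μ q (d ℕ.∸ g) ℕ.* μ q (suc g))
    ℕ.≤ cn ℕ.* (q ℕ.^ (d ℕ.∸ j ℕ.+ suc g) ℕ.* (μ q (j ℕ.∸ g) ℕ.* μ q (d ℕ.∸ i ℕ.∸ g))) →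
  ∣ T q d g i j ∣ ℚ.≤ c ℚ.* ∣ T q d (suc g) i j ∣
∣T∣-step-bound {q} {d} {i} {j} {g} c cn cd c*cd≡cn 1≤cd 2≤q g<j j≤d g<r bound =
  ≤-from-cross-multiplied c cn cd c*cd≡cn 1≤cd 1≤X (ℚP.0≤∣p∣ _) (∣T∣-ratio q d i j g 2≤q g<j j≤d g<r) bound
  where
  1≤X : 1 ℕ.≤ q ℕ.^ (d ℕ.∸ j ℕ.+ suc g) ℕ.* (μ q (j ℕ.∸ g) ℕ.* μ q (d ℕ.∸ i ℕ.∸ g))
  1≤X = ℕP.*-mono-≤ (ℕP.m^n>0 q {{ℕ.>-nonZero (ℕP.<-trans (s≤s z≤n) 2≤q)}} (d ℕ.∸ j ℕ.+ suc g))
    (ℕP.*-mono-≤ (1≤μ 2≤q (ℕP.m<n⇒0<n∸m g<j)) (1≤μ 2≤q (ℕP.m<n⇒0<n∸m g<r)))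

[d∸j+1+g]+[j∸g]≡[d∸g]+1+g : ∀ {d j g} → g ℕ.< j → j ℕ.≤ d →
  (d ℕ.∸ j ℕ.+ suc g) ℕ.+ (j ℕ.∸ g) ≡ (d ℕ.∸ g) ℕ.+ suc g
[d∸j+1+g]+[j∸g]≡[d∸g]+1+g {g = g} g<j j≤d with ℕP.m≤n⇒∃[o]m+o≡n g<j | ℕP.m≤n⇒∃[o]m+o≡n j≤d
... | t , refl | w , refl = begin
  (suc g ℕ.+ t ℕ.+ w ℕ.∸ (suc g ℕ.+ t) ℕ.+ suc g) ℕ.+ (suc g ℕ.+ t ℕ.∸ g)
    ≡⟨ cong₂ (λ x y → x ℕ.+ suc g ℕ.+ y) (ℕP.m+n∸m≡n (suc g ℕ.+ t) w) (1+g+t∸g≡1+t g t) ⟩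
  w ℕ.+ suc g ℕ.+ suc t
    ≡⟨ identity g t w ⟩
  suc t ℕ.+ w ℕ.+ suc g
    ≡⟨ cong (ℕ._+ suc g) (1+g+t∸g≡1+t g (t ℕ.+ w)) ⟨
  (suc g ℕ.+ (t ℕ.+ w) ℕ.∸ g) ℕ.+ suc g
    ≡⟨ cong (λ x → (x ℕ.∸ g) ℕ.+ suc g) (ℕP.+-assoc (suc g) t w) ⟨
  (suc g ℕ.+ t ℕ.+ w ℕ.∸ g) ℕ.+ suc g ∎
  where
  open ≡-Reasoning
  1+g+t∸g≡1+t : ∀ g t → suc g ℕ.+ t ℕ.∸ g ≡ suc t
  1+g+t∸g≡1+t g t = trans (cong (ℕ._∸ g) (sym (ℕP.+-suc g t))) (ℕP.m+n∸m≡n g (suc t))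
  identity : ∀ g t w → w ℕ.+ suc g ℕ.+ suc t ≡ suc t ℕ.+ w ℕ.+ suc g
  identity = solve-∀

[d∸g]+1+g≡1+d : ∀ {d g} → g ℕ.≤ d → (d ℕ.∸ g) ℕ.+ suc g ≡ suc d
[d∸g]+1+g≡1+d {d} {g} g≤d = trans (ℕP.+-suc (d ℕ.∸ g) g) (cong suc (ℕP.m∸n+n≡m g≤d))

d∸i∸g<d∸g : ∀ {d i g} → 1 ℕ.≤ i → g ℕ.< d ℕ.∸ i → d ℕ.∸ i ℕ.∸ g ℕ.< d ℕ.∸ g
d∸i∸g<d∸g {d} {i} {g} 1≤i g<d∸i = begin-strict
  d ℕ.∸ i ℕ.∸ g   ≡⟨ ℕP.∸-+-assoc d i g ⟩
  d ℕ.∸ (i ℕ.+ g) <⟨ ℕP.∸-monoʳ-< (ℕP.m<n+m g 1≤i) i+g≤d ⟩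
  d ℕ.∸ g ∎
  where
  open ℕP.≤-Reasoning
  i<d : i ℕ.< d
  i<d = ℕP.m∸n≢0⇒n<m (ℕP.m>n⇒m∸n≢0 (ℕP.<-≤-trans (s≤s z≤n) g<d∸i))
  i+g≤d : i ℕ.+ g ℕ.≤ d
  i+g≤d = ℕP.≤-trans (ℕP.≤-reflexive (ℕP.+-comm i g))
    (ℕP.≤-trans (ℕP.n≤1+n _) (ℕP.m≤o∸n⇒m+n≤o (suc g) (ℕP.<⇒≤ i<d) g<d∸i))

k+1+g≤j⇒1+k≤j∸g : ∀ {k g j} → k ℕ.+ suc g ℕ.≤ j → suc k ℕ.≤ j ℕ.∸ g
k+1+g≤j⇒1+k≤j∸g {k} {g} {j} k+1+g≤j =
  ℕP.m+n≤o⇒m≤o∸n (suc k) (ℕP.≤-trans (ℕP.≤-reflexive (sym (ℕP.+-suc k g))) k+1+g≤j)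

module TermRatios {q d i j : ℕ} (2≤q : 2 ℕ.≤ q) (6≤d : 6 ℕ.≤ d) (1≤i : 1 ℕ.≤ i) (j≤d : j ℕ.≤ d) where

  private
    r = d ℕ.∸ i

    -- For the pair (T_g, T_{g+1}): a = d - g, h = g + 1, u = j - g, e = d - i - g and D = d - j + g + 1.
    module Pair {g : ℕ} (g<j : g ℕ.< j) (g<r : g ℕ.< r) where
      D+u≡a+h : (d ℕ.∸ j ℕ.+ suc g) ℕ.+ (j ℕ.∸ g) ≡ (d ℕ.∸ g) ℕ.+ suc g
      D+u≡a+h = [d∸j+1+g]+[j∸g]≡[d∸g]+1+g g<j j≤d

      7≤a+h : 7 ℕ.≤ (d ℕ.∸ g) ℕ.+ suc g
      7≤a+h = ℕP.≤-trans (s≤s 6≤d) (ℕP.≤-reflexive (sym ([d∸g]+1+g≡1+d (ℕP.<⇒≤ (ℕP.<-≤-trans g<j j≤d)))))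

      1≤e : 1 ℕ.≤ r ℕ.∸ g
      1≤e = ℕP.m<n⇒0<n∸m g<r

      e<a : r ℕ.∸ g ℕ.< d ℕ.∸ g
      e<a = d∸i∸g<d∸g 1≤i g<r

      2≤a : 2 ℕ.≤ d ℕ.∸ g
      2≤a = ℕP.≤-trans (s≤s 1≤e) e<a

  ∣T∣-step-u≡1 : ∀ {g} → j ≡ suc g → g ℕ.< r → 1 ℕ.≤ g →
    ∣ T q d g i j ∣ ℚ.≤ ((+ 4) ℚ./ 15) ℚ.* ∣ T q d (suc g) i j ∣
  ∣T∣-step-u≡1 {g} refl g<r 1≤g = ∣T∣-step-bound {i = i} _ 4 15 refl (s≤s z≤n) 2≤q g<j j≤d g<r
    (step-bound-u≡1 2≤q 2≤a (s≤s 1≤g) 7≤a+h (ℕP.m+n∸n≡m 1 g) 1≤e D+u≡a+h)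
    where
    g<j = ℕP.≤-refl
    open Pair g<j g<r

  ∣T∣-step-u≥2 : ∀ {g} → 2 ℕ.+ g ℕ.≤ j → g ℕ.< r → 1 ℕ.≤ g →
    ∣ T q d g i j ∣ ℚ.≤ ((+ 13) ℚ./ 25) ℚ.* ∣ T q d (suc g) i j ∣
  ∣T∣-step-u≥2 {g} 2+g≤j g<r 1≤g = ∣T∣-step-bound {i = i} _ 13 25 refl (s≤s z≤n) 2≤q g<j j≤d g<r
    (step-bound-u≥2 2≤q 2≤a (s≤s 1≤g) 7≤a+h (k+1+g≤j⇒1+k≤j∸g 2+g≤j) 1≤e D+u≡a+h)
    where
    g<j = ℕP.<-trans (ℕP.n<1+n g) 2+g≤j
    open Pair g<j g<r

  ∣T∣-step-u≥3 : ∀ {g} → 3 ℕ.+ g ℕ.≤ j → g ℕ.< r → 1 ℕ.≤ g →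
    ∣ T q d g i j ∣ ℚ.≤ ((+ 9) ℚ./ 20) ℚ.* ∣ T q d (suc g) i j ∣
  ∣T∣-step-u≥3 {g} 3+g≤j g<r 1≤g = ∣T∣-step-bound {i = i} _ 9 20 refl (s≤s z≤n) 2≤q g<j j≤d g<r
    (step-bound-u≥3 2≤q 2≤a (s≤s 1≤g) 7≤a+h (k+1+g≤j⇒1+k≤j∸g 3+g≤j) 1≤e D+u≡a+h)
    where
    g<j = ℕP.≤-trans (ℕP.m≤n+m (suc g) 2) 3+g≤j
    open Pair g<j g<r

  ∣T∣-step-e≥3 : ∀ {g} → 2 ℕ.+ g ℕ.≤ j → 3 ℕ.+ g ℕ.≤ r →
    ∣ T q d g i j ∣ ℚ.≤ ((+ 3) ℚ./ 10) ℚ.* ∣ T q d (suc g) i j ∣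
  ∣T∣-step-e≥3 {g} 2+g≤j 3+g≤r = ∣T∣-step-bound {i = i} _ 3 10 refl (s≤s z≤n) 2≤q g<j j≤d g<r
    (step-bound-e≥3 2≤q (ℕP.≤-trans (s≤s 3≤e) e<a) (k+1+g≤j⇒1+k≤j∸g 2+g≤j) 3≤e D+u≡a+h)
    where
    g<j = ℕP.<-trans (ℕP.n<1+n g) 2+g≤j
    g<r = ℕP.≤-trans (ℕP.m≤n+m (suc g) 2) 3+g≤r
    3≤e = k+1+g≤j⇒1+k≤j∸g 3+g≤r
    open Pair g<j g<r

-- Geometric tails and the conclusion

module _ where
  open import Data.Rational using (_+_; _-_; _*_; -_; _≤_; _<_)
  open ℚP.≤-Reasoning

  sumTo-tail-step : ∀ (f : ℕ → ℚ) n {s c} → 0ℚ ≤ s →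
    ∣ sumTo n f - f n ∣ ≤ s * ∣ f n ∣ → ∣ f n ∣ ≤ c * ∣ f (suc n) ∣ →
    ∣ sumTo (suc n) f - f (suc n) ∣ ≤ ((1ℚ + s) * c) * ∣ f (suc n) ∣
  sumTo-tail-step f n {s} {c} 0≤s tail≤ fn≤ = begin
    ∣ (S + f (suc n)) - f (suc n) ∣  ≡⟨ cong ∣_∣ (solve 3 (λ S y x → (S :+ y) :- y := (S :- x) :+ x) refl S (f (suc n)) (f n)) ⟩
    ∣ (S - f n) + f n ∣              ≤⟨ ℚP.∣p+q∣≤∣p∣+∣q∣ (S - f n) (f n) ⟩
    ∣ S - f n ∣ + ∣ f n ∣            ≤⟨ ℚP.+-monoˡ-≤ ∣ f n ∣ tail≤ ⟩
    s * ∣ f n ∣ + ∣ f n ∣            ≡⟨ solve 2 (λ s x → s :* x :+ x := (con 1ℚ :+ s) :* x) refl s ∣ f n ∣ ⟩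
    (1ℚ + s) * ∣ f n ∣               ≤⟨ ℚP.*-monoˡ-≤-nonNeg (1ℚ + s) {{ℚ.nonNegative 0≤1+s}} fn≤ ⟩
    (1ℚ + s) * (c * ∣ f (suc n) ∣)   ≡⟨ ℚP.*-assoc (1ℚ + s) c ∣ f (suc n) ∣ ⟨
    ((1ℚ + s) * c) * ∣ f (suc n) ∣ ∎
    where
    S = sumTo n f
    0≤1+s : 0ℚ ≤ 1ℚ + s
    0≤1+s = ℚP.+-mono-≤ (ℚP.<⇒≤ (ℚP.positive⁻¹ 1ℚ)) 0≤s

  sumTo-tail-geometric : ∀ (f : ℕ → ℚ) n {s c} → 0ℚ ≤ s → (1ℚ + s) * c ≤ s →
    (∀ g → g ℕ.< n → ∣ f g ∣ ≤ c * ∣ f (suc g) ∣) →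
    ∣ sumTo n f - f n ∣ ≤ s * ∣ f n ∣
  sumTo-tail-geometric f zero {s} 0≤s _ _ = begin
    ∣ f 0 - f 0 ∣ ≡⟨ cong ∣_∣ (ℚP.+-inverseʳ (f 0)) ⟩
    0ℚ            ≡⟨ ℚP.*-zeroˡ ∣ f 0 ∣ ⟨
    0ℚ * ∣ f 0 ∣  ≤⟨ ℚP.*-monoʳ-≤-nonNeg ∣ f 0 ∣ {{ℚP.∣-∣-nonNeg (f 0)}} 0≤s ⟩
    s * ∣ f 0 ∣ ∎
  sumTo-tail-geometric f (suc n) {s} {c} 0≤s [1+s]c≤s ratio = begin
    ∣ sumTo (suc n) f - f (suc n) ∣ ≤⟨ sumTo-tail-step f n 0≤s tail (ratio n ℕP.≤-refl) ⟩
    ((1ℚ + s) * c) * ∣ f (suc n) ∣  ≤⟨ ℚP.*-monoʳ-≤-nonNeg ∣ f (suc n) ∣ {{ℚP.∣-∣-nonNeg (f (suc n))}} [1+s]c≤s ⟩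
    s * ∣ f (suc n) ∣ ∎
    where
    tail : ∣ sumTo n f - f n ∣ ≤ s * ∣ f n ∣
    tail = sumTo-tail-geometric f n 0≤s [1+s]c≤s (λ g g<n → ratio g (ℕP.m<n⇒m<1+n g<n))

  p≤∣p∣ : ∀ p → p ≤ ∣ p ∣
  p≤∣p∣ p with ℚP.≤-total p 0ℚ
  ... | inj₁ p≤0 = ℚP.≤-trans p≤0 (ℚP.0≤∣p∣ p)
  ... | inj₂ 0≤p = ℚP.≤-reflexive (sym (ℚP.0≤p⇒∣p∣≡p 0≤p))

  sign-pos : ∀ {x} → 0ℚ < x → sign x ≡ + 1
  sign-pos {x} 0<x with x ℚP.<? 0ℚ
  ... | yes x<0 = ⊥-elim (ℚP.<-asym x<0 0<x)
  ... | no _ with 0ℚ ℚP.<? x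
  ...   | yes _ = refl
  ...   | no 0≮x = ⊥-elim (0≮x 0<x)

  sign-neg : ∀ {x} → x < 0ℚ → sign x ≡ ℤ.- + 1
  sign-neg {x} x<0 with x ℚP.<? 0ℚ
  ... | yes _ = refl
  ... | no x≮0 = ⊥-elim (x≮0 x<0)

  sign-cong-close : ∀ {x y} → ∣ x - y ∣ < ∣ y ∣ → sign x ≡ sign y
  sign-cong-close {x} {y} close with ℚP.<-cmp y 0ℚ
  ... | tri< y<0 _ _ = trans (sign-neg x<0) (sym (sign-neg y<0))
    where
    ∣y∣≡-y : ∣ y ∣ ≡ - y
    ∣y∣≡-y = trans (sym (ℚP.∣-p∣≡∣p∣ y)) (ℚP.0≤p⇒∣p∣≡p (ℚP.<⇒≤ (ℚP.neg-antimono-< y<0)))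
    x<0 : x < 0ℚ
    x<0 = begin-strict
      x                ≡⟨ solve 2 (λ x y → x := (x :- y) :+ y) refl x y ⟩
      (x - y) + y      ≤⟨ ℚP.+-monoˡ-≤ y (p≤∣p∣ (x - y)) ⟩
      ∣ x - y ∣ + y    <⟨ ℚP.+-monoˡ-< y close ⟩
      ∣ y ∣ + y        ≡⟨ trans (cong (_+ y) ∣y∣≡-y) (ℚP.+-inverseˡ y) ⟩
      0ℚ ∎
  ... | tri≈ _ y≡0 _ = ⊥-elim (ℚP.<-irrefl refl (ℚP.<-≤-trans close ∣y∣≤∣x-y∣))
    where
    ∣y∣≤∣x-y∣ : ∣ y ∣ ≤ ∣ x - y ∣
    ∣y∣≤∣x-y∣ = subst (λ z → ∣ z ∣ ≤ ∣ x - y ∣) (sym y≡0) (ℚP.0≤∣p∣ (x - y))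
  ... | tri> _ _ 0<y = trans (sign-pos 0<x) (sym (sign-pos 0<y))
    where
    y-x≤∣x-y∣ : y - x ≤ ∣ x - y ∣
    y-x≤∣x-y∣ = ℚP.≤-trans (p≤∣p∣ (y - x))
      (ℚP.≤-reflexive (trans (cong ∣_∣ (solve 2 (λ x y → y :- x := :- (x :- y)) refl x y)) (ℚP.∣-p∣≡∣p∣ (x - y))))
    0<x : 0ℚ < x
    0<x = begin-strict
      0ℚ               ≡⟨ ℚP.+-inverseʳ y ⟨
      y - y            <⟨ ℚP.+-monoʳ-< y (ℚP.neg-antimono-< (subst (∣ x - y ∣ <_) (ℚP.0≤p⇒∣p∣≡p (ℚP.<⇒≤ 0<y)) close)) ⟩
      y - ∣ x - y ∣    ≤⟨ ℚP.+-monoʳ-≤ y (ℚP.neg-antimono-≤ y-x≤∣x-y∣) ⟩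
      y - (y - x)      ≡⟨ solve 2 (λ x y → y :- (y :- x) := x) refl x y ⟩
      x ∎

  close⇒between : ∀ {x y} s → ∣ x - y ∣ ≤ s * ∣ y ∣ → Between (1ℚ - s) (1ℚ + s) y x
  close⇒between {x} {y} s close = lower , upper
    where
    lower : (1ℚ - s) * ∣ y ∣ ≤ ∣ x ∣
    lower = begin
      (1ℚ - s) * ∣ y ∣                ≡⟨ solve 2 (λ s t → (con 1ℚ :- s) :* t := t :- s :* t) refl s ∣ y ∣ ⟩
      ∣ y ∣ - s * ∣ y ∣               ≤⟨ ℚP.+-monoʳ-≤ ∣ y ∣ (ℚP.neg-antimono-≤ close) ⟩
      ∣ y ∣ - ∣ x - y ∣               ≤⟨ ℚP.+-monoˡ-≤ (- ∣ x - y ∣) ∣y∣≤∣x∣+∣x-y∣ ⟩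
      (∣ x ∣ + ∣ x - y ∣) - ∣ x - y ∣ ≡⟨ solve 2 (λ a b → (a :+ b) :- b := a) refl ∣ x ∣ ∣ x - y ∣ ⟩
      ∣ x ∣ ∎
      where
      ∣y∣≤∣x∣+∣x-y∣ : ∣ y ∣ ≤ ∣ x ∣ + ∣ x - y ∣
      ∣y∣≤∣x∣+∣x-y∣ = begin
        ∣ y ∣             ≡⟨ cong ∣_∣ (solve 2 (λ x y → y := x :- (x :- y)) refl x y) ⟩
        ∣ x - (x - y) ∣   ≤⟨ ℚP.∣p-q∣≤∣p∣+∣q∣ x (x - y) ⟩
        ∣ x ∣ + ∣ x - y ∣ ∎
    upper : ∣ x ∣ ≤ (1ℚ + s) * ∣ y ∣
    upper = begin
      ∣ x ∣                ≡⟨ cong ∣_∣ (solve 2 (λ x y → x := y :+ (x :- y)) refl x y) ⟩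
      ∣ y + (x - y) ∣      ≤⟨ ℚP.∣p+q∣≤∣p∣+∣q∣ y (x - y) ⟩
      ∣ y ∣ + ∣ x - y ∣    ≤⟨ ℚP.+-monoʳ-≤ ∣ y ∣ close ⟩
      ∣ y ∣ + s * ∣ y ∣    ≡⟨ solve 2 (λ s t → t :+ s :* t := (con 1ℚ :+ s) :* t) refl s ∣ y ∣ ⟩
      (1ℚ + s) * ∣ y ∣ ∎

  close⇒sign≡ : ∀ {x y} s → ∣ x - y ∣ ≤ s * ∣ y ∣ → s < 1ℚ → sign x ≡ sign y
  close⇒sign≡ {x} {y} s close s<1 with ℚP.<-cmp 0ℚ ∣ y ∣
  ... | tri< 0<∣y∣ _ _ = sign-cong-close {x} {y} (begin-strict
    ∣ x - y ∣    ≤⟨ close ⟩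
    s * ∣ y ∣    <⟨ ℚP.*-monoˡ-<-pos ∣ y ∣ {{ℚ.positive 0<∣y∣}} s<1 ⟩
    1ℚ * ∣ y ∣   ≡⟨ ℚP.*-identityˡ ∣ y ∣ ⟩
    ∣ y ∣ ∎)
  ... | tri≈ _ 0≡∣y∣ _ = cong sign (trans x≡0 (sym y≡0))
    where
    y≡0 : y ≡ 0ℚ
    y≡0 = ℚP.∣p∣≡0⇒p≡0 y (sym 0≡∣y∣)
    x≡0 : x ≡ 0ℚ
    x≡0 = ℚP.∣p∣≡0⇒p≡0 x (ℚP.≤-antisym (begin
      ∣ x ∣         ≡⟨ cong ∣_∣ (ℚP.+-identityʳ x) ⟨
      ∣ x - 0ℚ ∣    ≡⟨ cong (λ z → ∣ x - z ∣) y≡0 ⟨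
      ∣ x - y ∣     ≤⟨ close ⟩
      s * ∣ y ∣     ≡⟨ cong (s *_) 0≡∣y∣ ⟨
      s * 0ℚ        ≡⟨ ℚP.*-zeroʳ s ⟩
      0ℚ ∎) (ℚP.0≤∣p∣ x))
  ... | tri> _ _ ∣y∣<0 = ⊥-elim (ℚP.<-irrefl refl (ℚP.<-≤-trans ∣y∣<0 (ℚP.0≤∣p∣ y)))

m≤n∸1⇒m<n : ∀ {m n} → 1 ℕ.≤ n → m ℕ.≤ n ℕ.∸ 1 → m ℕ.< n
m≤n∸1⇒m<n {n = suc n} _ m≤n = s≤s m≤n

3≤d∸i : ∀ {d i} → 3 ℕ.≤ d → i ℕ.≤ d ℕ.∸ 3 → 3 ℕ.≤ d ℕ.∸ i
3≤d∸i {d} {i} 3≤d i≤d∸3 =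
  ℕP.m+n≤o⇒m≤o∸n 3 (ℕP.≤-trans (ℕP.≤-reflexive (ℕP.+-comm 3 i)) (ℕP.m≤o∸n⇒m+n≤o i 3≤d i≤d∸3))

prime-power≥2 : ∀ {q} → IsPrimePower q → 2 ℕ.≤ q
prime-power≥2 (suc p , k , p-prime , refl) = ℕP.≤-trans (ℕ.nonTrivial⇒n>1 (suc p) {{prime⇒nonTrivial p-prime}})
  (ℕP.m≤m*n (suc p) (suc p ℕ.^ k) {{ℕP.m^n≢0 (suc p) k}})

module NearTopTerm {q d i j : ℕ} (2≤q : 2 ℕ.≤ q) (6≤d : 6 ℕ.≤ d) (1≤i : 1 ℕ.≤ i) (i≤d∸3 : i ℕ.≤ d ℕ.∸ 3)
            (2≤j : 2 ℕ.≤ j) (j≤d : j ℕ.≤ d) where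
  open TermRatios 2≤q 6≤d 1≤i j≤d
  open import Data.Rational using (_+_; _-_; _*_; _≤_; _/_)

  private
    r = d ℕ.∸ i
    3≤r = 3≤d∸i (ℕP.≤-trans (s≤s (s≤s (s≤s z≤n))) 6≤d) i≤d∸3
    H = hmax d i j
    f : ℕ → ℚ
    f g = T q d g i j

  Q-close : ∀ n (c₀ c₁ s₁ s₀ : ℚ) → H ≡ 2 ℕ.+ n → 2 ℕ.+ n ℕ.≤ j → 2 ℕ.+ n ℕ.≤ r →
    ∣ f n ∣ ≤ c₁ * ∣ f (1 ℕ.+ n) ∣ → ∣ f (1 ℕ.+ n) ∣ ≤ c₀ * ∣ f (2 ℕ.+ n) ∣ →
    (1ℚ + (+ 3) / 7) * c₁ ≤ s₁ → 0ℚ ≤ s₁ → (1ℚ + s₁) * c₀ ≤ s₀ →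
    ∣ Q q d i j - f H ∣ ≤ s₀ * ∣ f H ∣
  Q-close n c₀ c₁ s₁ s₀ H≡2+n 2+n≤j 2+n≤r fn≤ fn+1≤ c₁-budget 0≤s₁ c₀-budget =
    subst (λ h → ∣ sumTo h f - f h ∣ ≤ s₀ * ∣ f h ∣) (sym H≡2+n) (begin
      ∣ sumTo (2 ℕ.+ n) f - f (2 ℕ.+ n) ∣ ≤⟨ sumTo-tail-step f (1 ℕ.+ n) {s₁} {c₀} 0≤s₁ (weaken (1 ℕ.+ n) c₁-budget tail₁) fn+1≤ ⟩
      ((1ℚ + s₁) * c₀) * ∣ f (2 ℕ.+ n) ∣  ≤⟨ weaken-by (2 ℕ.+ n) c₀-budget ⟩
      s₀ * ∣ f (2 ℕ.+ n) ∣ ∎)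
    where
    open ℚP.≤-Reasoning
    weaken-by : ∀ m {a b} → a ≤ b → a * ∣ f m ∣ ≤ b * ∣ f m ∣
    weaken-by m = ℚP.*-monoʳ-≤-nonNeg ∣ f m ∣ {{ℚP.∣-∣-nonNeg (f m)}}
    weaken : ∀ m {a b} → a ≤ b → ∣ sumTo m f - f m ∣ ≤ a * ∣ f m ∣ → ∣ sumTo m f - f m ∣ ≤ b * ∣ f m ∣
    weaken m a≤b tail≤ = ℚP.≤-trans tail≤ (weaken-by m a≤b)
    -- 3/7 is the fixed point of s ↦ (1 + s) · 3/10.
    tail₀ : ∣ sumTo n f - f n ∣ ≤ ((+ 3) / 7) * ∣ f n ∣
    tail₀ = sumTo-tail-geometric f n {(+ 3) / 7} {(+ 3) / 10} (≤ℚ-by-computation tt) (≤ℚ-by-computation tt)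
      (λ g g<n → ∣T∣-step-e≥3 (ℕP.<⇒≤ (ℕP.≤-trans (s≤s (s≤s g<n)) 2+n≤j)) (ℕP.≤-trans (s≤s (s≤s g<n)) 2+n≤r))
    tail₁ : ∣ sumTo (1 ℕ.+ n) f - f (1 ℕ.+ n) ∣ ≤ ((1ℚ + (+ 3) / 7) * c₁) * ∣ f (1 ℕ.+ n) ∣
    tail₁ = sumTo-tail-step f n {(+ 3) / 7} {c₁} (≤ℚ-by-computation tt) tail₀ fn≤

  Q-close-below : j ℕ.≤ d ℕ.∸ i ℕ.∸ 1 →
    ∣ Q q d i j - T q d (hmax d i j) i j ∣ ≤ ((+ 35) / 78) * ∣ T q d (hmax d i j) i j ∣
  Q-close-below j≤r-1 with ℕP.m≤n⇒∃[o]m+o≡n 2≤j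
  ... | n , refl = Q-close n ((+ 4) / 15) ((+ 3) / 10) ((+ 3) / 7) ((+ 35) / 78) H≡j ℕP.≤-refl (ℕP.<⇒≤ j<r)
    (∣T∣-step-e≥3 ℕP.≤-refl j<r) (∣T∣-step-u≡1 refl (ℕP.<⇒≤ j<r) (s≤s z≤n))
    (≤ℚ-by-computation tt) (≤ℚ-by-computation tt) (≤ℚ-by-computation tt)
    where
    j<r : 2 ℕ.+ n ℕ.< r
    j<r = m≤n∸1⇒m<n (ℕP.≤-trans (s≤s z≤n) 3≤r) j≤r-1
    H≡j : H ≡ 2 ℕ.+ n
    H≡j = ℕP.m≤n⇒m⊓n≡m (ℕP.<⇒≤ j<r)

  Q-close-equal : j ≡ d ℕ.∸ i →
    ∣ Q q d i j - T q d (hmax d i j) i j ∣ ≤ ((+ 605) / 1296) * ∣ T q d (hmax d i j) i j ∣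
  Q-close-equal j≡r with ℕP.m≤n⇒∃[o]m+o≡n 2≤j
  ... | n , refl = Q-close n ((+ 4) / 15) ((+ 13) / 25) ((+ 26) / 35) ((+ 605) / 1296) H≡j ℕP.≤-refl (ℕP.≤-reflexive j≡r)
    (∣T∣-step-u≥2 ℕP.≤-refl n<r 1≤n) (∣T∣-step-u≡1 refl (ℕP.<-≤-trans (ℕP.n<1+n (suc n)) (ℕP.≤-reflexive j≡r)) (s≤s z≤n))
    (≤ℚ-by-computation tt) (≤ℚ-by-computation tt) (≤ℚ-by-computation tt)
    where
    H≡j : H ≡ 2 ℕ.+ n
    H≡j = ℕP.m≤n⇒m⊓n≡m (ℕP.≤-reflexive j≡r)
    n<r : n ℕ.< r
    n<r = ℕP.<-≤-trans (ℕP.m<n+m n (s≤s z≤n)) (ℕP.≤-reflexive j≡r)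
    1≤n : 1 ℕ.≤ n
    1≤n = ℕP.+-cancelˡ-≤ 2 1 n (ℕP.≤-trans 3≤r (ℕP.≤-reflexive (sym j≡r)))

  Q-close-above : d ℕ.∸ i ℕ.+ 1 ℕ.≤ j →
    ∣ Q q d i j - T q d (hmax d i j) i j ∣ ≤ ((+ 185) / 216) * ∣ T q d (hmax d i j) i j ∣
  Q-close-above r+1≤j with ℕP.m≤n⇒∃[o]m+o≡n (ℕP.≤-trans (s≤s (s≤s z≤n)) 3≤r)
  ... | n , 2+n≡r = Q-close n ((+ 13) / 25) ((+ 9) / 20) ((+ 9) / 14) ((+ 185) / 216) H≡r (ℕP.<⇒≤ 2+n<j) (ℕP.≤-reflexive 2+n≡r)
    (∣T∣-step-u≥3 2+n<j n<r 1≤n) (∣T∣-step-u≥2 2+n<j (ℕP.<-≤-trans (ℕP.n<1+n (suc n)) (ℕP.≤-reflexive 2+n≡r)) (s≤s z≤n))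
    (≤ℚ-by-computation tt) (≤ℚ-by-computation tt) (≤ℚ-by-computation tt)
    where
    2+n<j : 2 ℕ.+ n ℕ.< j
    2+n<j = ℕP.≤-trans (ℕP.≤-reflexive (trans (cong suc 2+n≡r) (ℕP.+-comm 1 r))) r+1≤j
    H≡r : H ≡ 2 ℕ.+ n
    H≡r = trans (ℕP.m≥n⇒m⊓n≡n (ℕP.≤-trans (ℕP.m≤m+n r 1) r+1≤j)) (sym 2+n≡r)
    n<r : n ℕ.< r
    n<r = ℕP.<-≤-trans (ℕP.m<n+m n (s≤s z≤n)) (ℕP.≤-reflexive 2+n≡r)
    1≤n : 1 ℕ.≤ n
    1≤n = ℕP.+-cancelˡ-≤ 2 1 n (ℕP.≤-trans 3≤r (ℕP.≤-reflexive (sym 2+n≡r)))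

open import Data.Nat using (ℕ; _≤_; _∸_; _+_)
open import Data.Integer using (+_)
open import Data.Rational using (_/_)
open import Data.Product using (_×_)

lemma5p4 : (q d i j : ℕ) → IsPrimePower q → 6 ≤ d → 2 ≤ j → j ≤ d → 1 ≤ i → i ≤ d ∸ 3 →
    ((j ≤ d ∸ i ∸ 1 →
        Between ((+ 43) / 78) ((+ 113) / 78) (T q d (hmax d i j) i j) (Q q d i j))
    × (j ≡ d ∸ i →
        Between ((+ 691) / 1296) ((+ 1901) / 1296) (T q d (hmax d i j) i j) (Q q d i j))
    × (d ∸ i + 1 ≤ j →
        Between ((+ 31) / 216) ((+ 401) / 216) (T q d (hmax d i j) i j) (Q q d i j)))
    × (sign (Q q d i j) ≡ sign (T q d (hmax d i j) i j))
lemma5p4 q d i j q-prime-power 6≤d 2≤j j≤d 1≤i i≤d∸3 =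
  ( (λ below → close⇒between ((+ 35) / 78) (Q-close-below below))
  , (λ equal → close⇒between ((+ 605) / 1296) (Q-close-equal equal))
  , (λ above → close⇒between ((+ 185) / 216) (Q-close-above above)) )
  , sign-agrees
  where
  open NearTopTerm (prime-power≥2 q-prime-power) 6≤d 1≤i i≤d∸3 2≤j j≤d
  Tmax = T q d (hmax d i j) i j
  sign-agrees : sign (Q q d i j) ≡ sign Tmax
  sign-agrees with ℕP.<-cmp j (d ∸ i)
  ... | tri< j<r _ _ = close⇒sign≡ {Q q d i j} {Tmax} ((+ 35) / 78)
    (Q-close-below (ℕP.∸-monoˡ-≤ 1 j<r)) (<ℚ-by-computation tt)
  ... | tri≈ _ j≡r _ = close⇒sign≡ {Q q d i j} {Tmax} ((+ 605) / 1296)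
    (Q-close-equal j≡r) (<ℚ-by-computation tt)
  ... | tri> _ _ r<j = close⇒sign≡ {Q q d i j} {Tmax} ((+ 185) / 216)
    (Q-close-above (ℕP.≤-trans (ℕP.≤-reflexive (ℕP.+-comm (d ∸ i) 1)) r<j)) (<ℚ-by-computation tt)
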